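{- Let $\mathcal{F}$ and $\mathcal{G}$ be odd-sunflower-free families on disjoint base sets, and suppose at least one of them is an antichain. Then the direct sum $\mathcal{F}+\mathcal{G}=\{F\cup G: F\in\mathcal{F}, G\in\mathcal{G}\}$ is odd-sunflower-free. Moreover, if both $\mathcal{F}$ and $\mathcal{G}$ are antichains, then so is $\mathcal{F}+\mathcal{G}$.
   Context: A family of at least two nonempty sets is an odd-sunflower if every element of the underlying set is contained in an odd number of its sets, or in none; a family is odd-sunflower-free if none of its subfamilies is an odd-sunflower. A family is an antichain if $F,G\in\mathcal{F}$, $F\subseteq G$ imply $F=G$. -}

module Defs where

open import Data.Bool using (Bool; true; false; if_then_else_)
open import Data.Nat using (ℕ; zero; suc; _+_; _%_; _≥_)
open import Data.Fin using (Fin)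
open import Data.Fin.Subset using (Subset; _⊆_; Nonempty)
open import Data.Vec using (lookup; _++_)
open import Data.List using (List; []; _∷_; length)
open import Data.List.Relation.Unary.All using (All)
open import Data.List.Relation.Unary.Unique.Propositional using (Unique)
open import Data.Product using (Σ; ∃; _×_)
open import Data.Sum using (_⊎_)
open import Relation.Binary.PropositionalEquality using (_≡_)
open import Relation.Nullary using (¬_)

Family : ℕ → Set₁
Family n = Subset n → Set

count : ∀ {n} → Fin n → List (Subset n) → ℕ
count x [] = 0
count x (S ∷ L) = if lookup S x then suc (count x L) else count x L

IsOddSunflower : ∀ {n} → List (Subset n) → Set
IsOddSunflower {n} L =
  Unique L × length L ≥ 2 × All Nonempty L ×
  (∀ (x : Fin n) → count x L ≡ 0 ⊎ count x L % 2 ≡ 1)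

OddSunflowerFree : ∀ {n} → Family n → Set
OddSunflowerFree {n} F = ∀ (L : List (Subset n)) → All F L → ¬ IsOddSunflower L

Antichain : ∀ {n} → Family n → Set
Antichain {n} F = ∀ (A B : Subset n) → F A → F B → A ⊆ B → A ≡ B

-- Direct sum of families on the disjoint base sets Fin n and Fin m, living on
-- Fin (n + m) (first n coordinates for F, last m for G): {A ∪ B}.
_⊕_ : ∀ {n m} → Family n → Family m → Family (n + m)
(F ⊕ G) H = ∃ λ A → ∃ λ B → F A × G B × H ≡ A ++ B

-- Suppose F is an antichain and the sets A ∪ B (A ∈ F, B ∈ G) of a subfamily of F + G form
-- an odd-sunflower.  Cancelling equal F-parts in pairs and discarding empty ones leaves a
-- duplicate-free subfamily of F with the same parities, so, F being odd-sunflower-free, it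
-- has at most one member C.  Then every element outside C has even, hence zero, count, so
-- every A lies in C and, F being an antichain, equals C.  The G-parts B are therefore
-- pairwise distinct with the counts of the sunflower, and at least two of them are
-- nonempty (if C ≠ ∅, an element of C shows that the subfamily has an odd number ≥ 3 of
-- members, of which at most one has B = ∅): an odd-sunflower in G.
module Submission where

open import Defs
open import Data.Bool using (true; false; if_then_else_) renaming (_≟_ to _≟ᵇ_)
open import Data.Nat using (ℕ; zero; suc; _+_; _*_; _%_; _≤_; _≥_; z≤n; s≤s; s≤s⁻¹)
open import Data.Nat.Properties using (m+n≡0⇒m≡0; +-comm; +-assoc; *-distribʳ-+; ≤-refl; ≤-trans)
open import Data.Nat.DivMod using ([m+kn]%n≡m%n)
open import Data.Fin using (Fin; _↑ˡ_; _↑ʳ_)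
open import Data.Fin.Subset using (Subset; _⊆_; _∈_; _∉_; Nonempty; Empty)
open import Data.Fin.Subset.Properties using (_∈?_; nonempty?; Empty-unique; drop-∷-⊆)
open import Data.Vec using ([]; _∷_; lookup; _++_; here; there)
open import Data.Vec.Properties using (≡-dec; []=⇒lookup; lookup⇒[]=; lookup-++ˡ; lookup-++ʳ)
open import Data.List using (List; []; _∷_; length; map; filter; foldr)
open import Data.List.Properties using (length-map; map-∘; filter-all)
open import Data.List.Relation.Unary.All using (All; []; _∷_)
import Data.List.Relation.Unary.All as All
import Data.List.Relation.Unary.All.Properties as All
open import Data.List.Membership.Propositional using () renaming (_∈_ to _∈ₗ_)
open import Data.List.Relation.Unary.AllPairs using ([]; _∷_)
open import Data.List.Relation.Unary.Unique.Propositional using (Unique)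
import Data.List.Relation.Unary.Unique.Propositional.Properties as Unique
open import Data.Product using (∃; _×_; _,_; proj₁; proj₂; swap)
open import Data.Sum using (_⊎_; inj₁; inj₂; [_,_]′)
import Data.Sum as Sum
open import Data.Empty using (⊥-elim)
open import Relation.Nullary using (¬_; yes; no; Dec)
open import Relation.Nullary.Decidable using (decidable-stable)
open import Relation.Binary.PropositionalEquality

OddOrZero : ℕ → Set
OddOrZero c = c ≡ 0 ⊎ c % 2 ≡ 1

OddCounts : ∀ {n} → List (Subset n) → Set
OddCounts {n} L = ∀ (x : Fin n) → OddOrZero (count x L)

oddOrZero-minus-even : ∀ {r c} → (∃ λ k → r + k * 2 ≡ c) → OddOrZero c → OddOrZero r
oddOrZero-minus-even {r} (k , e) (inj₁ c≡0) = inj₁ (m+n≡0⇒m≡0 r (trans e c≡0))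
oddOrZero-minus-even {r} (k , e) (inj₂ c-odd) =
  inj₂ (trans (sym ([m+kn]%n≡m%n r k 2)) (trans (cong (_% 2) e) c-odd))

oddOrZero-even⇒zero : ∀ {r c} → r ≡ 0 → (∃ λ k → r + k * 2 ≡ c) → OddOrZero c → c ≡ 0
oddOrZero-even⇒zero r≡0 _ (inj₁ c≡0) = c≡0
oddOrZero-even⇒zero refl (k , e) (inj₂ c-odd)
  with trans (sym ([m+kn]%n≡m%n 0 k 2)) (trans (cong (_% 2) e) c-odd)
... | ()

oddOrZero-≥2⇒≥3 : ∀ c → 2 ≤ c → OddOrZero c → 3 ≤ c
oddOrZero-≥2⇒≥3 (suc zero) (s≤s ()) _
oddOrZero-≥2⇒≥3 (suc (suc zero)) _ (inj₂ ())
oddOrZero-≥2⇒≥3 (suc (suc (suc c))) _ _ = s≤s (s≤s (s≤s z≤n))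

module _ {n : ℕ} {x : Fin n} where

  count-∷-∈ : ∀ {S : Subset n} L → x ∈ S → count x (S ∷ L) ≡ suc (count x L)
  count-∷-∈ L x∈S rewrite []=⇒lookup x∈S = refl

  count-∷-∉ : ∀ {S : Subset n} L → x ∉ S → count x (S ∷ L) ≡ count x L
  count-∷-∉ {S} L x∉S with lookup S x in eq
  ... | true = ⊥-elim (x∉S (lookup⇒[]= x S eq))
  ... | false = refl

  count≡0⇒All∉ : ∀ L → count x L ≡ 0 → All (x ∉_) L
  count≡0⇒All∉ [] _ = []
  count≡0⇒All∉ (S ∷ L) e with x ∈? S
  ... | yes x∈S with () ← trans (sym (count-∷-∈ L x∈S)) e
  ... | no x∉S = x∉S ∷ count≡0⇒All∉ L (trans (sym (count-∷-∉ L x∉S)) e)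

  All∉⇒count≡0 : ∀ L → All (x ∉_) L → count x L ≡ 0
  All∉⇒count≡0 [] [] = refl
  All∉⇒count≡0 (S ∷ L) (x∉S ∷ x∉L) = trans (count-∷-∉ L x∉S) (All∉⇒count≡0 L x∉L)

  All∈⇒count≡length : ∀ L → All (x ∈_) L → count x L ≡ length L
  All∈⇒count≡length [] [] = refl
  All∈⇒count≡length (S ∷ L) (x∈S ∷ x∈L) =
    trans (count-∷-∈ L x∈S) (cong suc (All∈⇒count≡length L x∈L))

  count-filter-nonempty : ∀ L → count x (filter nonempty? L) ≡ count x L
  count-filter-nonempty [] = refl
  count-filter-nonempty (S ∷ L) with nonempty? S
  ... | yes _ = cong (λ c → if lookup S x then suc c else c) (count-filter-nonempty L)
  ... | no S-empty = trans (count-filter-nonempty L) (sym (count-∷-∉ L λ x∈S → S-empty (x , x∈S)))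

covered-by : ∀ {n} (C : Subset n) L → (∀ x → x ∉ C → count x L ≡ 0) → All (_⊆ C) L
covered-by C L vanishing = All.tabulate A⊆C
  where
  A⊆C : ∀ {A} → A ∈ₗ L → A ⊆ C
  A⊆C A∈L {x} x∈A with x ∈? C
  ... | yes x∈C = x∈C
  ... | no x∉C = ⊥-elim (All.lookup (count≡0⇒All∉ L (vanishing x x∉C)) A∈L x∈A)

module _ {n : ℕ} where

  _≟_ : (A B : Subset n) → Dec (A ≡ B)
  _≟_ = ≡-dec _≟ᵇ_

  toggle : Subset n → List (Subset n) → List (Subset n)
  toggle A [] = A ∷ []
  toggle A (S ∷ L) with A ≟ S
  ... | yes _ = L
  ... | no _ = S ∷ toggle A L

  -- The sets occurring an odd number of times in L, each once.
  oddPart : List (Subset n) → List (Subset n)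
  oddPart = foldr toggle []

  All-toggle : ∀ {P : Subset n → Set} {A} L → P A → All P L → All P (toggle A L)
  All-toggle [] PA [] = PA ∷ []
  All-toggle {A = A} (S ∷ L) PA (PS ∷ PL) with A ≟ S
  ... | yes _ = PL
  ... | no _ = PS ∷ All-toggle L PA PL

  All-oddPart : ∀ {P : Subset n → Set} L → All P L → All P (oddPart L)
  All-oddPart [] [] = []
  All-oddPart (A ∷ L) (PA ∷ PL) = All-toggle (oddPart L) PA (All-oddPart L PL)

  Unique-toggle : ∀ A L → Unique L → Unique (toggle A L)
  Unique-toggle A [] [] = [] ∷ []
  Unique-toggle A (S ∷ L) (S∉L ∷ L!) with A ≟ S
  ... | yes _ = L!
  ... | no A≢S = All-toggle L (λ S≡A → A≢S (sym S≡A)) S∉L ∷ Unique-toggle A L L!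

  Unique-oddPart : ∀ L → Unique (oddPart L)
  Unique-oddPart [] = []
  Unique-oddPart (A ∷ L) = Unique-toggle A (oddPart L) (Unique-oddPart L)

  module _ (x : Fin n) where

    count-∷-swap : ∀ S T L → count x (S ∷ T ∷ L) ≡ count x (T ∷ S ∷ L)
    count-∷-swap S T L with lookup S x | lookup T x
    ... | true | true = refl
    ... | true | false = refl
    ... | false | true = refl
    ... | false | false = refl

    count-∷-shift : ∀ S L₁ L₂ j →
      count x L₁ + j ≡ count x L₂ → count x (S ∷ L₁) + j ≡ count x (S ∷ L₂)
    count-∷-shift S L₁ L₂ j e with lookup S x
    ... | true = cong suc e
    ... | false = e

    count-toggle : ∀ A L → ∃ λ k → count x (toggle A L) + k * 2 ≡ count x (A ∷ L)
    count-toggle A [] = 0 , +-comm _ 0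
    count-toggle A (S ∷ L) with A ≟ S
    ... | yes refl with lookup A x
    ...   | true = 1 , +-comm _ 2
    ...   | false = 0 , +-comm _ 0
    count-toggle A (S ∷ L) | no _ with count-toggle A L
    ... | k , e = k , trans (count-∷-shift S (toggle A L) (A ∷ L) (k * 2) e) (count-∷-swap S A L)

    count-oddPart : ∀ L → ∃ λ k → count x (oddPart L) + k * 2 ≡ count x L
    count-oddPart [] = 0 , refl
    count-oddPart (A ∷ L) with count-toggle A (oddPart L) | count-oddPart L
    ... | k₁ , e₁ | k₂ , e₂ = k₁ + k₂ , (begin
      t + (k₁ + k₂) * 2       ≡⟨ cong (t +_) (*-distribʳ-+ 2 k₁ k₂) ⟩
      t + (k₁ * 2 + k₂ * 2)   ≡⟨ +-assoc t (k₁ * 2) (k₂ * 2) ⟨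
      t + k₁ * 2 + k₂ * 2     ≡⟨ cong (_+ k₂ * 2) e₁ ⟩
      count x (A ∷ oddPart L) + k₂ * 2  ≡⟨ count-∷-shift A (oddPart L) L (k₂ * 2) e₂ ⟩
      count x (A ∷ L)         ∎)
      where
      open ≡-Reasoning
      t = count x (oddPart (A ∷ L))

EvenlyBelow : ∀ {n} → List (Subset n) → List (Subset n) → Set
EvenlyBelow {n} R L = ∀ (x : Fin n) → ∃ λ k → count x R + k * 2 ≡ count x L

nonempty-oddPart-evenlyBelow : ∀ {n} (L : List (Subset n)) → EvenlyBelow (filter nonempty? (oddPart L)) L
nonempty-oddPart-evenlyBelow L x with count-oddPart x L
... | k , e = k , trans (cong (_+ k * 2) (count-filter-nonempty (oddPart L))) e

nonempty-if-distinct-from-empty : ∀ {n} {S T : Subset n} → Empty S → S ≢ T → Nonempty T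
nonempty-if-distinct-from-empty {T = T} S-empty S≢T =
  decidable-stable (nonempty? T) λ T-empty →
    S≢T (trans (Empty-unique S-empty) (sym (Empty-unique T-empty)))

length-filter-nonempty : ∀ {n} (L : List (Subset n)) → Unique L →
  length L ≤ suc (length (filter nonempty? L))
length-filter-nonempty [] [] = z≤n
length-filter-nonempty (S ∷ L) (S∉L ∷ L!) with nonempty? S
... | yes _ = s≤s (length-filter-nonempty L L!)
... | no S-empty
  rewrite filter-all nonempty? (All.map (nonempty-if-distinct-from-empty S-empty) S∉L) = ≤-refl

module _ {n : ℕ} {H : Family n} (free : OddSunflowerFree H) where

  vanishing-outside-member : ∀ {C₀} L R → H C₀ → All H R → Unique R → All Nonempty R →
    EvenlyBelow R L → OddCounts L → ∃ λ C → H C × (∀ x → x ∉ C → count x L ≡ 0)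
  vanishing-outside-member L [] HC₀ _ _ _ below odd =
    _ , HC₀ , λ x _ → oddOrZero-even⇒zero refl (below x) (odd x)
  vanishing-outside-member L (C ∷ []) _ (HC ∷ []) _ _ below odd =
    C , HC , λ x x∉C → oddOrZero-even⇒zero (count-∷-∉ [] x∉C) (below x) (odd x)
  vanishing-outside-member L R@(_ ∷ _ ∷ _) _ HR R! R-nonempty below odd =
    ⊥-elim (free R HR (R! , s≤s (s≤s z≤n) , R-nonempty ,
      λ x → oddOrZero-minus-even (below x) (odd x)))

  odd-cover : ∀ A L → All H (A ∷ L) → OddCounts (A ∷ L) → ∃ λ C → H C × All (_⊆ C) (A ∷ L)
  odd-cover A L H-L odd with vanishing-outside-member (A ∷ L) R (All.head H-L)
      (All.filter⁺ nonempty? (All-oddPart (A ∷ L) H-L))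
      (Unique.filter⁺ nonempty? (Unique-oddPart (A ∷ L)))
      (All.all-filter nonempty? (oddPart (A ∷ L))) (nonempty-oddPart-evenlyBelow (A ∷ L)) odd
    where R = filter nonempty? (oddPart (A ∷ L))
  ... | C , HC , vanishing = C , HC , covered-by C (A ∷ L) vanishing

nonempty-++⁻ : ∀ {n m} (A : Subset n) {B : Subset m} → Nonempty (A ++ B) → Nonempty A ⊎ Nonempty B
nonempty-++⁻ [] B-nonempty = inj₂ B-nonempty
nonempty-++⁻ (_ ∷ A) (Fin.zero , here) = inj₁ (Fin.zero , here)
nonempty-++⁻ (_ ∷ A) (Fin.suc x , there x∈A++B) =
  Sum.map₁ (λ (y , y∈A) → Fin.suc y , there y∈A) (nonempty-++⁻ A (x , x∈A++B))

count-map : ∀ {X : Set} {n m} (f : X → Subset n) (g : X → Subset m) {x y} →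
  (∀ S → lookup (f S) x ≡ lookup (g S) y) → ∀ L → count x (map f L) ≡ count y (map g L)
count-map f g same [] = refl
count-map f g same (S ∷ L) rewrite same S | count-map f g same L = refl

map-pair-fst : ∀ {X Y : Set} {C : X} (P : List (X × Y)) →
  All (λ p → proj₁ p ≡ C) P → map (C ,_) (map proj₂ P) ≡ P
map-pair-fst [] [] = refl
map-pair-fst (_ ∷ P) (refl ∷ fst≡C) = cong (_ ∷_) (map-pair-fst P fst≡C)

unique-snd : ∀ {X Y : Set} {C : X} (P : List (X × Y)) →
  All (λ p → proj₁ p ≡ C) P → Unique P → Unique (map proj₂ P)
unique-snd P fst≡C P! = Unique.map⁻ (subst Unique (sym (map-pair-fst P fst≡C)) P!)

nonempty-snd : ∀ {n m} {C : Subset n} (P : List (Subset n × Subset m)) → Empty C →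
  All (λ p → proj₁ p ≡ C) P → All (λ p → Nonempty (proj₁ p) ⊎ Nonempty (proj₂ p)) P →
  All Nonempty (map proj₂ P)
nonempty-snd [] _ [] [] = []
nonempty-snd (_ ∷ P) C-empty (refl ∷ _) (inj₁ A-nonempty ∷ _) = ⊥-elim (C-empty A-nonempty)
nonempty-snd (_ ∷ P) C-empty (refl ∷ fst≡C) (inj₂ B-nonempty ∷ nonempty) =
  B-nonempty ∷ nonempty-snd P C-empty fst≡C nonempty

record PairedOddSunflower {n m : ℕ} (P : List (Subset n × Subset m)) : Set where
  field
    unique : Unique P
    size : length P ≥ 2
    nonempty : All (λ p → Nonempty (proj₁ p) ⊎ Nonempty (proj₂ p)) P
    oddˡ : OddCounts (map proj₁ P)
    oddʳ : OddCounts (map proj₂ P)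

module _ {n m : ℕ} where

  join : Subset n × Subset m → Subset (n + m)
  join (A , B) = A ++ B

  split-sunflower : ∀ P → IsOddSunflower (map join P) → PairedOddSunflower P
  split-sunflower P (P! , size , nonempty , odd) = record
    { unique = Unique.map⁻ P!
    ; size = subst (2 ≤_) (length-map join P) size
    ; nonempty = All.map (λ {(A , B)} → nonempty-++⁻ A) (All.map⁻ nonempty)
    ; oddˡ = λ x → subst OddOrZero (count-map join proj₁ (λ (A , B) → lookup-++ˡ A B x) P) (odd (x ↑ˡ m))
    ; oddʳ = λ y → subst OddOrZero (count-map join proj₂ (λ (A , B) → lookup-++ʳ A B y) P) (odd (n ↑ʳ y))
    }

  swap-sunflower : ∀ {P : List (Subset n × Subset m)} →
    PairedOddSunflower P → PairedOddSunflower (map swap P)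
  swap-sunflower {P} sf = record
    { unique = Unique.map⁺ (cong swap) unique
    ; size = subst (2 ≤_) (sym (length-map swap P)) size
    ; nonempty = All.map⁺ (All.map Sum.swap nonempty)
    ; oddˡ = λ y → subst (λ L → OddOrZero (count y L)) (map-∘ P) (oddʳ y)
    ; oddʳ = λ x → subst (λ L → OddOrZero (count x L)) (map-∘ P) (oddˡ x)
    }
    where open PairedOddSunflower sf

module _ {n m : ℕ} {F : Family n} {G : Family m}
         (antichain : Antichain F) (freeF : OddSunflowerFree F) (freeG : OddSunflowerFree G) where

  no-paired-sunflower : ∀ P → All F (map proj₁ P) → All G (map proj₂ P) → ¬ PairedOddSunflower P
  no-paired-sunflower [] _ _ sf with () ← PairedOddSunflower.size sf
  no-paired-sunflower P@(p ∷ ps) F-As G-Bs sf =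
    freeG (filter nonempty? Bs) (All.filter⁺ nonempty? G-Bs)
      ( Unique.filter⁺ nonempty? Bs! , at-least-two , All.all-filter nonempty? Bs
      , λ y → subst OddOrZero (sym (count-filter-nonempty Bs)) (oddʳ y))
    where
    open PairedOddSunflower sf
    As = map proj₁ P
    Bs = map proj₂ P

    cover = odd-cover freeF (proj₁ p) (map proj₁ ps) F-As oddˡ
    C = proj₁ cover

    As≡C : All (_≡ C) As
    As≡C = All.zipWith maximal (F-As , proj₂ (proj₂ cover))
      where
      maximal : ∀ {A} → F A × A ⊆ C → A ≡ C
      maximal (F-A , A⊆C) = antichain _ C F-A (proj₁ (proj₂ cover)) A⊆C

    Bs! : Unique Bs
    Bs! = unique-snd P (All.map⁻ As≡C) unique

    length-As≡length-Bs : length As ≡ length Bs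
    length-As≡length-Bs = trans (length-map proj₁ P) (sym (length-map proj₂ P))

    at-least-two : 2 ≤ length (filter nonempty? Bs)
    at-least-two with nonempty? C
    ... | no C-empty = subst (2 ≤_) (sym length-filter-Bs) size
      where
      length-filter-Bs : length (filter nonempty? Bs) ≡ length P
      length-filter-Bs = trans
        (cong length (filter-all nonempty? (nonempty-snd P C-empty (All.map⁻ As≡C) nonempty)))
        (length-map proj₂ P)
    ... | yes (x , x∈C) =
      s≤s⁻¹ (≤-trans (subst (3 ≤_) length-As≡length-Bs three) (length-filter-nonempty Bs Bs!))
      where
      three : 3 ≤ length As
      three = oddOrZero-≥2⇒≥3 (length As) (subst (2 ≤_) (sym (length-map proj₁ P)) size)
        (subst OddOrZero (All∈⇒count≡length As (All.map (λ { refl → x∈C }) As≡C)) (oddˡ x))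

++-⊆ˡ : ∀ {k m} (A₁ A₂ : Subset k) {B₁ B₂ : Subset m} → A₁ ++ B₁ ⊆ A₂ ++ B₂ → A₁ ⊆ A₂
++-⊆ˡ (_ ∷ _) (_ ∷ _) A₁B₁⊆A₂B₂ here with A₁B₁⊆A₂B₂ here
... | here = here
++-⊆ˡ (_ ∷ A₁) (_ ∷ A₂) A₁B₁⊆A₂B₂ (there x∈A₁) =
  there (++-⊆ˡ A₁ A₂ (drop-∷-⊆ A₁B₁⊆A₂B₂) x∈A₁)

++-⊆ʳ : ∀ {k m} (A₁ A₂ : Subset k) {B₁ B₂ : Subset m} → A₁ ++ B₁ ⊆ A₂ ++ B₂ → B₁ ⊆ B₂
++-⊆ʳ [] [] B₁⊆B₂ = B₁⊆B₂
++-⊆ʳ (_ ∷ A₁) (_ ∷ A₂) A₁B₁⊆A₂B₂ = ++-⊆ʳ A₁ A₂ (drop-∷-⊆ A₁B₁⊆A₂B₂)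

module _ {n m : ℕ} {F : Family n} {G : Family m} where

  decompose : ∀ {L} → All (F ⊕ G) L →
    ∃ λ P → map join P ≡ L × All F (map proj₁ P) × All G (map proj₂ P)
  decompose [] = [] , refl , [] , []
  decompose ((A , B , F-A , G-B , refl) ∷ FGs) with decompose FGs
  ... | P , refl , F-As , G-Bs = (A , B) ∷ P , refl , F-A ∷ F-As , G-B ∷ G-Bs

  ⊕-oddSunflowerFree : OddSunflowerFree F → OddSunflowerFree G →
    Antichain F ⊎ Antichain G → OddSunflowerFree (F ⊕ G)
  ⊕-oddSunflowerFree freeF freeG antichain L FGs sf with decompose FGs
  ... | P , refl , F-As , G-Bs =
    [ (λ antichainF → no-paired-sunflower antichainF freeF freeG P F-As G-Bs paired)
    , (λ antichainG → no-paired-sunflower antichainG freeG freeF (map swap P)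
        (subst (All G) (map-∘ P) G-Bs) (subst (All F) (map-∘ P) F-As) (swap-sunflower paired))
    ]′ antichain
    where
    paired = split-sunflower P sf

  ⊕-antichain : Antichain F → Antichain G → Antichain (F ⊕ G)
  ⊕-antichain antichainF antichainG _ _ (A₁ , B₁ , F-A₁ , G-B₁ , refl) (A₂ , B₂ , F-A₂ , G-B₂ , refl) A₁B₁⊆A₂B₂ =
    cong₂ _++_ (antichainF A₁ A₂ F-A₁ F-A₂ (++-⊆ˡ A₁ A₂ A₁B₁⊆A₂B₂))
               (antichainG B₁ B₂ G-B₁ G-B₂ (++-⊆ʳ A₁ A₂ A₁B₁⊆A₂B₂))

lemma4 : ∀ (n m : ℕ) (F : Family n) (G : Family m) →
    OddSunflowerFree F → OddSunflowerFree G → (Antichain F ⊎ Antichain G) →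
    OddSunflowerFree (F ⊕ G) × (Antichain F → Antichain G → Antichain (F ⊕ G))
lemma4 n m F G freeF freeG antichain = ⊕-oddSunflowerFree freeF freeG antichain , ⊕-antichain
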